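{- For every positive integer $n$, the graph $H_{2n+1,2n+3}\circ C_4$ is not distance magic, where $H_{2n+1,2n+3}$ is the graph on vertices $v_0,\dots,v_{2n+2}$ in which $v_0$ is adjacent to all other vertices and, for $1\le i<j\le 2n+2$, $v_i\sim v_j$ iff $j\ne i+n+1$.
   Context: The lexicographic product $G\circ H$ has vertex set $V(G)\times V(H)$, with $(g,h)\sim(g',h')$ iff $gg'\in E(G)$, or $g=g'$ and $hh'\in E(H)$. A distance magic labeling of a graph on $N$ vertices is a bijection $f:V\to\{1,\dots,N\}$ such that $\sum_{v\in N(u)}f(v)$ is the same for all vertices $u$; a graph is distance magic if it has one. The given graph is the Harary graph $H_{2n+1,2n+3}$. -}

module Defs where

open import Data.Nat using (ℕ; zero; suc; _+_; _*_; _≡ᵇ_)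
open import Data.Fin using (Fin; toℕ; remQuot)
open import Data.Fin.Properties using (_≟_)
open import Data.Bool using (Bool; true; false; _∧_; _∨_; not; if_then_else_)
open import Data.Product using (_×_; _,_; proj₁; proj₂; ∃)
open import Data.List using (List; map; allFin)
open import Data.Nat.ListAction using (sum)
open import Relation.Nullary.Decidable using (⌊_⌋)
import Relation.Nullary
import Data.Empty
open import Relation.Binary.PropositionalEquality using (_≡_)
open import Function.Bundles using (Bijection)
open import Function using (_∘_)
open import Level using (0ℓ)

record Graph (N : ℕ) : Set where
  field
    adj   : Fin N → Fin N → Bool
    sym   : ∀ u v → adj u v ≡ adj v u
    irref : ∀ u → adj u u ≡ false
open Graph public

ΣFin : (N : ℕ) → (Fin N → ℕ) → ℕ
ΣFin N f = sum (map f (allFin N))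

-- Weight of u under labeling f : V → Fin N (label of v is toℕ (f v) + 1, i.e. labels 1..N):
-- sum of labels of the neighbours of u.
weight : ∀ {N} → Graph N → (Fin N → Fin N) → Fin N → ℕ
weight {N} G f u = ΣFin N (λ v → if adj G u v then suc (toℕ (f v)) else 0)

IsDistanceMagicLabeling : ∀ {N} → Graph N → (Fin N → Fin N) → Set
IsDistanceMagicLabeling {N} G f =
  (∀ x y → f x ≡ f y → x ≡ y) × (∀ y → ∃ λ x → f x ≡ y) ×
  (∀ u v → weight G f u ≡ weight G f v)

DistanceMagic : ∀ {N} → Graph N → Set
DistanceMagic {N} G = ∃ λ (f : Fin N → Fin N) → IsDistanceMagicLabeling G f

_==_ : ∀ {N} → Fin N → Fin N → Bool
i == j = ⌊ i ≟ j ⌋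

-- Lexicographic product G ∘ H on Fin (a * b), vertex (g , h) encoded via combine g h.
-- (g,h) ~ (g',h') iff g g' ∈ E(G), or g = g' and h h' ∈ E(H).
lexAdj : ∀ {a b} → Graph a → Graph b → Fin (a * b) → Fin (a * b) → Bool
lexAdj {a} {b} G H x y with remQuot {a} b x | remQuot {a} b y
... | (g , h) | (g' , h') = adj G g g' ∨ ((g == g') ∧ adj H h h')

infix 4 _=ℕ_
_=ℕ_ : ℕ → ℕ → Bool
m =ℕ n = m ≡ᵇ n

hararyAdj : (n : ℕ) → Fin (2 * n + 3) → Fin (2 * n + 3) → Bool
hararyAdj n i j =
  not (toℕ i =ℕ toℕ j) ∧
  ((toℕ i =ℕ 0) ∨ (toℕ j =ℕ 0) ∨
   not ((toℕ j =ℕ toℕ i + n + 1) ∨ (toℕ i =ℕ toℕ j + n + 1)))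

-- cycle C_4 on Fin 4: 0-1-2-3-0, i.e. i ~ j iff i + j is odd.
odd : ℕ → Bool
odd zero = false
odd (suc k) = not (odd k)

c4Adj : Fin 4 → Fin 4 → Bool
c4Adj i j = odd (toℕ i + toℕ j)

open import Relation.Binary.PropositionalEquality using (refl; cong; cong₂)
open import Data.Bool.Properties using (∨-comm; ∧-comm)
open import Data.Nat.Properties using (+-comm)

=ℕ-sym : ∀ m n → (m =ℕ n) ≡ (n =ℕ m)
=ℕ-sym zero zero = refl
=ℕ-sym zero (suc n) = refl
=ℕ-sym (suc m) zero = refl
=ℕ-sym (suc m) (suc n) = =ℕ-sym m n

=ℕ-refl : ∀ m → (m =ℕ m) ≡ true
=ℕ-refl zero = refl
=ℕ-refl (suc m) = =ℕ-refl m

private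



  swap4 : ∀ p q r s → (p ∨ q ∨ not (r ∨ s)) ≡ (q ∨ p ∨ not (s ∨ r))
  swap4 true true r s = refl
  swap4 true false true true = refl
  swap4 true false true false = refl
  swap4 true false false true = refl
  swap4 true false false false = refl
  swap4 false true true true = refl
  swap4 false true true false = refl
  swap4 false true false true = refl
  swap4 false true false false = refl
  swap4 false false true true = refl
  swap4 false false true false = refl
  swap4 false false false true = refl
  swap4 false false false false = refl

  andFalse : ∀ {a} b → a ≡ true → (not a ∧ b) ≡ false
  andFalse b refl = refl

harary : (n : ℕ) → Graph (2 * n + 3)
harary n = record
  { adj = hararyAdj n
  ; sym = λ i j → cong₂ _∧_ (cong not (=ℕ-sym (toℕ i) (toℕ j)))
      (swap4 (toℕ i =ℕ 0) (toℕ j =ℕ 0) (toℕ j =ℕ toℕ i + n + 1) (toℕ i =ℕ toℕ j + n + 1))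
  ; irref = λ i → andFalse _ (=ℕ-refl (toℕ i))
  }

odd-sym : ∀ a b → odd (a + b) ≡ odd (b + a)
odd-sym a b = cong odd (+-comm a b)

odd-double : ∀ a → odd (a + a) ≡ false
odd-double zero = refl
odd-double (suc a) rewrite Data.Nat.Properties.+-suc a a with odd (a + a) | odd-double a
... | false | refl = refl

c4 : Graph 4
c4 = record { adj = c4Adj ; sym = λ i j → odd-sym (toℕ i) (toℕ j) ; irref = λ i → odd-double (toℕ i) }

==-sym : ∀ {N} (i j : Fin N) → (i == j) ≡ (j == i)
==-sym i j with i ≟ j | j ≟ i
... | Relation.Nullary.yes _ | Relation.Nullary.yes _ = refl
... | Relation.Nullary.no _ | Relation.Nullary.no _ = refl
... | Relation.Nullary.yes refl | Relation.Nullary.no ¬p = Data.Empty.⊥-elim (¬p refl)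
... | Relation.Nullary.no ¬p | Relation.Nullary.yes refl = Data.Empty.⊥-elim (¬p refl)
  where import Data.Empty

private
  lexIrr : ∀ {a b} (G : Graph a) (H : Graph b) g h → (adj G g g ∨ ((g == g) ∧ adj H h h)) ≡ false
  lexIrr G H g h rewrite irref G g | irref H h | Data.Bool.Properties.∧-zeroʳ (g == g) = refl

_∘ᴳ_ : ∀ {a b} → Graph a → Graph b → Graph (a * b)
_∘ᴳ_ {a} {b} G H = record
  { adj = lexAdj G H
  ; sym = λ x y → cong₂ _∨_ (sym G (proj₁ (remQuot {a} b x)) (proj₁ (remQuot {a} b y)))
                    (cong₂ _∧_ (==-sym (proj₁ (remQuot {a} b x)) (proj₁ (remQuot {a} b y)))
                               (sym H (proj₂ (remQuot {a} b x)) (proj₂ (remQuot {a} b y))))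
  ; irref = λ x → lexIrr G H (proj₁ (remQuot {a} b x)) (proj₂ (remQuot {a} b x))
  }

-- Let M = 2m + 3 be the number of vertices of H = H_{2m+1,2m+3} (m ≥ 1), N = 4M, and let S g be the
-- sum of the labels on the copy {g} × C₄. In C₄ the neighbourhoods of two adjacent vertices
-- partition the cycle, so adding the weights of (g,0) and (g,1) gives 2k = 2 Σ_{g′∼g} S g′ + S g.
-- The apex of H is adjacent to every other vertex, and any other vertex g to all but itself and
-- its antipode p (the unique j ≥ 1 with |g − j| = m + 1); the three resulting equations give
-- S g = S p = S apex / 3. So the total label sum N(N+1)/2 equals (M + 2) · S apex / 3, forcing
-- S apex > 4N, although it is a sum of four labels at most N.
module Submission where

open import Data.Bool using (Bool; true; false; not; _∧_; _∨_; if_then_else_)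
open import Data.Bool.Properties using (∧-identityʳ)
open import Data.Empty using (⊥-elim)
open import Data.Fin using (Fin; zero; suc; toℕ; fromℕ<; combine; _↑ˡ_; _↑ʳ_)
open import Data.Fin.Permutation using (Permutation; permutation)
open import Data.Fin.Properties as Fin using (toℕ<n; toℕ-fromℕ<; remQuot-combine)
open import Data.List using (map; tabulate)
import Data.Nat.ListAction as List
open import Data.Nat using (ℕ; zero; suc; _+_; _*_; _∸_; _≤_; _<_; z≤n; s≤s; _≤?_; NonZero; >-nonZero)
open import Data.Nat.Properties
open import Data.Nat.Tactic.RingSolver using (solve-∀)
open import Data.Product using (_×_; _,_; proj₁; proj₂; ∃)
open import Data.Sum as Sum using (_⊎_; inj₁; inj₂)
open import Function using (_∘_; mk⇔)
open import Relation.Binary.PropositionalEquality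
open import Relation.Nullary using (¬_; yes; no; _⊎-dec_)
open import Relation.Nullary.Decidable using (⌊_⌋; ⌊⌋-map′; isYes≗does; does-⇔)
open import Algebra.Properties.CommutativeMonoid.Sum +-0-commutativeMonoid
  using (sum; sum-syntax; sum-cong-≗; sum-replicate-zero; ∑-distrib-+; ∑-permute)
open import Algebra.Properties.Semiring.Sum +-*-semiring using (*-distribˡ-sum)

open import Defs hiding (sym)

listSum-tabulate : ∀ {m} n (g : Fin n → Fin m) (x : Fin m → ℕ) →
  List.sum (map x (tabulate g)) ≡ sum (x ∘ g)
listSum-tabulate zero    g x = refl
listSum-tabulate (suc n) g x = cong (x (g zero) +_) (listSum-tabulate n (g ∘ suc) x)

ΣFin≡sum : ∀ N (x : Fin N → ℕ) → ΣFin N x ≡ sum x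
ΣFin≡sum N x = listSum-tabulate N (λ i → i) x

sum-↑ : ∀ a b (x : Fin (a + b) → ℕ) →
  sum x ≡ sum (λ i → x (i ↑ˡ b)) + sum (λ j → x (a ↑ʳ j))
sum-↑ zero    b x = refl
sum-↑ (suc a) b x = trans (cong (x zero +_) (sum-↑ a b (x ∘ suc))) (sym (+-assoc (x zero) _ _))

sum-combine : ∀ a b (x : Fin (a * b) → ℕ) → sum x ≡ ∑[ g < a ] ∑[ h < b ] x (combine g h)
sum-combine zero    b x = refl
sum-combine (suc a) b x =
  trans (sum-↑ b (a * b) x) (cong (sum (λ h → x (h ↑ˡ (a * b))) +_) (sum-combine a b (x ∘ (b ↑ʳ_))))

-- `suc i == suc j` is not definitionally `i == j`: ⌊_⌋ is stuck on the `map′` in `Fin._≟_`.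
sum-δ : ∀ {n} (i : Fin n) (x : Fin n → ℕ) → ∑[ j < n ] (if i == j then x j else 0) ≡ x i
sum-δ {suc n} zero    x = trans (cong (x zero +_) (sum-replicate-zero n)) (+-identityʳ (x zero))
sum-δ {suc n} (suc i) x =
  trans (sum-cong-≗ λ j → cong (if_then x (suc j) else 0) (⌊⌋-map′ _ _ (i Fin.≟ j))) (sum-δ i (x ∘ suc))

sum-≤ : ∀ {n} (x : Fin n → ℕ) {c} → (∀ i → x i ≤ c) → sum x ≤ n * c
sum-≤ {zero}  x x≤c = z≤n
sum-≤ {suc n} x x≤c = +-mono-≤ (x≤c zero) (sum-≤ (x ∘ suc) (x≤c ∘ suc))

sum-const : ∀ n c → ∑[ i < n ] c ≡ n * c
sum-const zero    c = refl
sum-const (suc n) c = cong (c +_) (sum-const n c)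

*-sum-const : ∀ {n} a (x : Fin n → ℕ) {c} → (∀ i → a * x i ≡ c) → a * sum x ≡ n * c
*-sum-const {n} a x {c} ax≡c = trans (*-distribˡ-sum a x) (trans (sum-cong-≗ ax≡c) (sum-const n c))

sum-∘-bijection : ∀ {N} (x : Fin N → ℕ) (f : Fin N → Fin N) →
  (∀ u v → f u ≡ f v → u ≡ v) → (∀ v → ∃ λ u → f u ≡ v) → sum (x ∘ f) ≡ sum x
sum-∘-bijection x f inj surj = sym (∑-permute x π)
  where
  π : Permutation _ _
  π = permutation f (proj₁ ∘ surj) (proj₂ ∘ surj) (λ u → inj _ _ (proj₂ (surj (f u))))

sum-suc-toℕ : ∀ N → 2 * ∑[ i < N ] suc (toℕ i) ≡ N * suc N
sum-suc-toℕ zero    = refl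
sum-suc-toℕ (suc N) = begin
  2 * (1 + ∑[ i < N ] (1 + suc (toℕ i)))  ≡⟨ cong (λ t → 2 * (1 + t)) (∑-distrib-+ {N} (λ _ → 1) _) ⟩
  2 * (1 + (∑[ i < N ] 1 + σ))            ≡⟨ cong (λ t → 2 * (1 + (t + σ))) (sum-const N 1) ⟩
  2 * (1 + (N * 1 + σ))                   ≡⟨ regroupˡ N σ ⟩
  2 * (1 + N) + 2 * σ                     ≡⟨ cong (2 * (1 + N) +_) (sum-suc-toℕ N) ⟩
  2 * (1 + N) + N * suc N                 ≡⟨ regroupʳ N ⟩
  suc N * suc (suc N)                     ∎
  where
  open ≡-Reasoning
  σ : ℕ
  σ = ∑[ i < N ] suc (toℕ i)
  regroupˡ : ∀ N σ → 2 * (1 + (N * 1 + σ)) ≡ 2 * (1 + N) + 2 * σ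
  regroupˡ = solve-∀
  regroupʳ : ∀ N → 2 * (1 + N) + N * suc N ≡ suc N * suc (suc N)
  regroupʳ = solve-∀

label : ∀ {N} → (Fin N → Fin N) → Fin N → ℕ
label f v = suc (toℕ (f v))

sum-label : ∀ {N} (f : Fin N → Fin N) →
  (∀ u v → f u ≡ f v → u ≡ v) → (∀ v → ∃ λ u → f u ≡ v) → 2 * sum (label f) ≡ N * suc N
sum-label {N} f inj surj =
  trans (cong (2 *_) (sum-∘-bijection (suc ∘ toℕ) f inj surj)) (sum-suc-toℕ N)

nbrSum : ∀ {N} → Graph N → (Fin N → ℕ) → Fin N → ℕ
nbrSum {N} G x u = ∑[ v < N ] (if adj G u v then x v else 0)

weight≡nbrSum : ∀ {N} (G : Graph N) f u → weight G f u ≡ nbrSum G (label f) u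
weight≡nbrSum {N} G f u = ΣFin≡sum N _

if-not : ∀ b (y : ℕ) → (if not b then 0 else y) ≡ (if b then y else 0)
if-not false y = refl
if-not true  y = refl

module _ {N} (G : Graph N) (x : Fin N → ℕ) (u : Fin N) where

  nbrSum-complement : nbrSum G x u + ∑[ v < N ] (if adj G u v then 0 else x v) ≡ sum x
  nbrSum-complement = trans (sym (∑-distrib-+ {N} _ _)) (sum-cong-≗ λ v → split (adj G u v) (x v))
    where
    split : ∀ b y → (if b then y else 0) + (if b then 0 else y) ≡ y
    split false y = refl
    split true  y = +-identityʳ y

  nbrSum-dominating : (∀ v → adj G u v ≡ not (u == v)) → nbrSum G x u + x u ≡ sum x
  nbrSum-dominating adj≡ = begin
    nbrSum G x u + x u                                        ≡⟨ cong (nbrSum G x u +_) (sum-δ u x) ⟨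
    nbrSum G x u + ∑[ v < N ] (if u == v then x v else 0)     ≡⟨ cong (nbrSum G x u +_) (sum-cong-≗ nonNbr) ⟩
    nbrSum G x u + ∑[ v < N ] (if adj G u v then 0 else x v)  ≡⟨ nbrSum-complement ⟩
    sum x                                                     ∎
    where
    open ≡-Reasoning
    nonNbr : ∀ v → (if u == v then x v else 0) ≡ (if adj G u v then 0 else x v)
    nonNbr v rewrite adj≡ v = sym (if-not (u == v) (x v))

  nbrSum-all-but : ∀ {p} → u ≢ p → (∀ v → adj G u v ≡ not (u == v) ∧ not (p == v)) →
    nbrSum G x u + x u + x p ≡ sum x
  nbrSum-all-but {p} u≢p adj≡ = begin
    nbrSum G x u + x u + x p
      ≡⟨ +-assoc (nbrSum G x u) (x u) (x p) ⟩
    nbrSum G x u + (x u + x p)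
      ≡⟨ cong (nbrSum G x u +_) (sym (cong₂ _+_ (sum-δ u x) (sum-δ p x))) ⟩
    nbrSum G x u + (∑[ v < N ] (if u == v then x v else 0) + ∑[ v < N ] (if p == v then x v else 0))
      ≡⟨ cong (nbrSum G x u +_) (trans (sym (∑-distrib-+ {N} _ _)) (sum-cong-≗ nonNbr)) ⟩
    nbrSum G x u + ∑[ v < N ] (if adj G u v then 0 else x v)
      ≡⟨ nbrSum-complement ⟩
    sum x ∎
    where
    open ≡-Reasoning
    nonNbr : ∀ v → (if u == v then x v else 0) + (if p == v then x v else 0)
                   ≡ (if adj G u v then 0 else x v)
    nonNbr v rewrite adj≡ v with u Fin.≟ v | p Fin.≟ v
    ... | yes refl | yes refl = ⊥-elim (u≢p refl)
    ... | yes _    | no _     = +-identityʳ (x v)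
    ... | no _     | q?       = sym (if-not ⌊ q? ⌋ (x v))

blockSum : ∀ {a b} → (Fin (a * b) → ℕ) → Fin a → ℕ
blockSum {b = b} x g = ∑[ h < b ] x (combine g h)

module _ {a b} (G : Graph a) (H : Graph b) where

  lexAdj-combine : ∀ g h g′ h′ →
    lexAdj G H (combine g h) (combine g′ h′) ≡ adj G g g′ ∨ ((g == g′) ∧ adj H h h′)
  lexAdj-combine g h g′ h′ =
    cong₂ lexAdjPair (remQuot-combine {a} {b} g h) (remQuot-combine {a} {b} g′ h′)
    where
    lexAdjPair : Fin a × Fin b → Fin a × Fin b → Bool
    lexAdjPair (g , h) (g′ , h′) = adj G g g′ ∨ ((g == g′) ∧ adj H h h′)

  nbrSum-∘ᴳ : ∀ (x : Fin (a * b) → ℕ) g h →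
    nbrSum (G ∘ᴳ H) x (combine g h) ≡ nbrSum G (blockSum x) g + nbrSum H (x ∘ combine g) h
  nbrSum-∘ᴳ x g h = begin
    nbrSum (G ∘ᴳ H) x (combine g h)
      ≡⟨ sum-combine a b _ ⟩
    ∑[ g′ < a ] ∑[ h′ < b ] (if lexAdj G H (combine g h) (combine g′ h′) then x (combine g′ h′) else 0)
      ≡⟨ sum-cong-≗ (λ g′ → sum-cong-≗ λ h′ →
           cong (if_then x (combine g′ h′) else 0) (lexAdj-combine g h g′ h′)) ⟩
    ∑[ g′ < a ] ∑[ h′ < b ] (if adj G g g′ ∨ ((g == g′) ∧ adj H h h′) then x (combine g′ h′) else 0)
      ≡⟨ sum-cong-≗ layer ⟩
    ∑[ g′ < a ] ((if adj G g g′ then blockSum x g′ else 0) + (if g == g′ then nbrSum H (x ∘ combine g′) h else 0))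
      ≡⟨ ∑-distrib-+ {a} _ _ ⟩
    nbrSum G (blockSum x) g + ∑[ g′ < a ] (if g == g′ then nbrSum H (x ∘ combine g′) h else 0)
      ≡⟨ cong (nbrSum G (blockSum x) g +_) (sum-δ g (λ g′ → nbrSum H (x ∘ combine g′) h)) ⟩
    nbrSum G (blockSum x) g + nbrSum H (x ∘ combine g) h ∎
    where
    open ≡-Reasoning
    layer : ∀ g′ →
      ∑[ h′ < b ] (if adj G g g′ ∨ ((g == g′) ∧ adj H h h′) then x (combine g′ h′) else 0)
        ≡ (if adj G g g′ then blockSum x g′ else 0)
          + (if g == g′ then nbrSum H (x ∘ combine g′) h else 0)
    layer g′ with g Fin.≟ g′
    ... | yes refl rewrite irref G g = refl
    ... | no _ with adj G g g′
    ...   | true  = sym (+-identityʳ _)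
    ...   | false = sum-replicate-zero b

nbrSum-c4 : ∀ (x : Fin 4 → ℕ) → nbrSum c4 x zero + nbrSum c4 x (suc zero) ≡ sum x
nbrSum-c4 x = regroup (x zero) (x (suc zero)) (x (suc (suc zero))) (x (suc (suc (suc zero))))
  where
  regroup : ∀ x₀ x₁ x₂ x₃ →
    (0 + (x₁ + (0 + (x₃ + 0)))) + (x₀ + (0 + (x₂ + (0 + 0)))) ≡ x₀ + (x₁ + (x₂ + (x₃ + 0)))
  regroup = solve-∀

nbrSum-∘c4 : ∀ {a} (G : Graph a) (x : Fin (a * 4) → ℕ) g →
  nbrSum (G ∘ᴳ c4) x (combine g zero) + nbrSum (G ∘ᴳ c4) x (combine g (suc zero))
    ≡ 2 * nbrSum G (blockSum x) g + blockSum x g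
nbrSum-∘c4 G x g = begin
  nbrSum (G ∘ᴳ c4) x (combine g zero) + nbrSum (G ∘ᴳ c4) x (combine g (suc zero))
    ≡⟨ cong₂ _+_ (nbrSum-∘ᴳ G c4 x g zero) (nbrSum-∘ᴳ G c4 x g (suc zero)) ⟩
  (D + nbrSum c4 (x ∘ combine g) zero) + (D + nbrSum c4 (x ∘ combine g) (suc zero))
    ≡⟨ regroup D _ _ ⟩
  2 * D + (nbrSum c4 (x ∘ combine g) zero + nbrSum c4 (x ∘ combine g) (suc zero))
    ≡⟨ cong (2 * D +_) (nbrSum-c4 (x ∘ combine g)) ⟩
  2 * D + blockSum x g ∎
  where
  open ≡-Reasoning
  D : ℕ
  D = nbrSum G (blockSum x) g
  regroup : ∀ d s t → (d + s) + (d + t) ≡ 2 * d + (s + t)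
  regroup = solve-∀

balanced-copies : ∀ {a} (G : Graph a) (f : Fin (a * 4) → Fin (a * 4)) →
  (∀ u v → weight (G ∘ᴳ c4) f u ≡ weight (G ∘ᴳ c4) f v) →
  ∀ w g → weight (G ∘ᴳ c4) f w + weight (G ∘ᴳ c4) f w
          ≡ 2 * nbrSum G (blockSum (label f)) g + blockSum (label f) g
balanced-copies G f magic w g = begin
  weight (G ∘ᴳ c4) f w + weight (G ∘ᴳ c4) f w
    ≡⟨ cong₂ _+_ (magic w (combine g zero)) (magic w (combine g (suc zero))) ⟩
  weight (G ∘ᴳ c4) f (combine g zero) + weight (G ∘ᴳ c4) f (combine g (suc zero))
    ≡⟨ cong₂ _+_ (weight≡nbrSum (G ∘ᴳ c4) f _) (weight≡nbrSum (G ∘ᴳ c4) f _) ⟩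
  nbrSum (G ∘ᴳ c4) (label f) (combine g zero) + nbrSum (G ∘ᴳ c4) (label f) (combine g (suc zero))
    ≡⟨ nbrSum-∘c4 G (label f) g ⟩
  2 * nbrSum G (blockSum (label f)) g + blockSum (label f) g ∎
  where open ≡-Reasoning

Antipodal : ℕ → ℕ → ℕ → Set
Antipodal m i j = j ≡ i + m + 1 ⊎ i ≡ j + m + 1

antipodal-sym : ∀ {m i j} → Antipodal m i j → Antipodal m j i
antipodal-sym = Sum.swap

antipodal-irrefl : ∀ {m i} → ¬ Antipodal m i i
antipodal-irrefl {m} {i} = Sum.[ noFix , noFix ]
  where
  noFix : i ≢ i + m + 1
  noFix i≡ = m+1+n≢m i (sym (trans i≡ (trans (+-assoc i m 1) (cong (i +_) (+-comm m 1)))))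

shift-twice-overflows : ∀ m x → 1 ≤ x → 2 * m + 3 ≤ x + m + 1 + m + 1
shift-twice-overflows m (suc x) _ = ≤-trans (m≤m+n (2 * m + 3) x) (≤-reflexive (regroup m x))
  where
  regroup : ∀ m x → 2 * m + 3 + x ≡ suc x + m + 1 + m + 1
  regroup = solve-∀

antipode-unique : ∀ {m i j p} → 1 ≤ j → 1 ≤ p → j < 2 * m + 3 → p < 2 * m + 3 →
  Antipodal m i j → Antipodal m i p → j ≡ p
antipode-unique _ _ _ _ (inj₁ refl) (inj₁ refl) = refl
antipode-unique {m} _ 1≤p j<M _ (inj₁ refl) (inj₂ refl) =
  ⊥-elim (<⇒≱ j<M (shift-twice-overflows m _ 1≤p))
antipode-unique {m} 1≤j _ _ p<M (inj₂ refl) (inj₁ refl) =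
  ⊥-elim (<⇒≱ p<M (shift-twice-overflows m _ 1≤j))
antipode-unique {m} _ _ _ _ (inj₂ i≡j+m+1) (inj₂ i≡p+m+1) =
  +-cancelʳ-≡ m _ _ (+-cancelʳ-≡ 1 _ _ (trans (sym i≡j+m+1) i≡p+m+1))

antipodeℕ : ∀ {m i} → 1 ≤ i → i < 2 * m + 3 → ∃ λ j → 1 ≤ j × j < 2 * m + 3 × Antipodal m i j
antipodeℕ {m} {i} 1≤i i<M with i ≤? m + 1
... | yes i≤m+1 = i + m + 1 , ≤-trans 1≤i (≤-trans (m≤m+n i m) (m≤m+n (i + m) 1)) , j<M , inj₁ refl
  where
  j<M : i + m + 1 < 2 * m + 3
  j<M = begin
    suc (i + m + 1)   ≡⟨ regroupˡ i m ⟩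
    i + (m + 2)       ≤⟨ +-monoˡ-≤ (m + 2) i≤m+1 ⟩
    m + 1 + (m + 2)   ≡⟨ regroupʳ m ⟩
    2 * m + 3         ∎
    where
    open ≤-Reasoning
    regroupˡ : ∀ i m → suc (i + m + 1) ≡ i + (m + 2)
    regroupˡ = solve-∀
    regroupʳ : ∀ m → m + 1 + (m + 2) ≡ 2 * m + 3
    regroupʳ = solve-∀
... | no i≰m+1 =
  i ∸ (m + 1) , m<n⇒0<n∸m (≰⇒> i≰m+1) , ≤-<-trans (m∸n≤m i (m + 1)) i<M , inj₂ i≡j+m+1
  where
  i≡j+m+1 : i ≡ i ∸ (m + 1) + m + 1
  i≡j+m+1 = sym (trans (+-assoc (i ∸ (m + 1)) m 1) (m∸n+n≡m (<⇒≤ (≰⇒> i≰m+1))))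

antipode : ∀ {m} (g : Fin (2 * m + 3)) → 1 ≤ toℕ g →
  ∃ λ p → 1 ≤ toℕ p × Antipodal m (toℕ g) (toℕ p)
antipode {m} g 1≤g with antipodeℕ 1≤g (toℕ<n g)
... | j , 1≤j , j<M , ap =
  fromℕ< j<M , subst (λ q → 1 ≤ q × Antipodal m (toℕ g) q) (sym (toℕ-fromℕ< j<M)) (1≤j , ap)

==-toℕ : ∀ {N} (i j : Fin N) → (i == j) ≡ (toℕ i =ℕ toℕ j)
==-toℕ i j = trans (isYes≗does (i Fin.≟ j))
  (does-⇔ (mk⇔ (cong toℕ) Fin.toℕ-injective) (i Fin.≟ j) (toℕ i ≟ toℕ j))

module _ {m : ℕ} where

  harary-apex-adj : ∀ {o : Fin (2 * m + 3)} → toℕ o ≡ 0 → ∀ v → adj (harary m) o v ≡ not (o == v)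
  harary-apex-adj {o} o≡0 v rewrite ==-toℕ o v | o≡0 = ∧-identityʳ _

  antipodal-clause : ∀ {i p j} → 1 ≤ i → 1 ≤ p → p < 2 * m + 3 → j < 2 * m + 3 → Antipodal m i p →
    ((i =ℕ 0) ∨ (j =ℕ 0) ∨ not ((j =ℕ i + m + 1) ∨ (i =ℕ j + m + 1))) ≡ not (p =ℕ j)
  antipodal-clause {suc i} {suc p} {zero}  _ _ _   _   _  = refl
  antipodal-clause {suc i} {suc p} {suc j} _ _ p<M j<M ap = cong not
    (does-⇔ (mk⇔ (λ aj → antipode-unique (s≤s z≤n) (s≤s z≤n) p<M j<M ap aj) (λ { refl → ap }))
            ((suc j ≟ suc i + m + 1) ⊎-dec (suc i ≟ suc j + m + 1)) (suc p ≟ suc j))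

  harary-antipodal-adj : ∀ {g p : Fin (2 * m + 3)} →
    1 ≤ toℕ g → 1 ≤ toℕ p → Antipodal m (toℕ g) (toℕ p) → ∀ v → adj (harary m) g v ≡ not (g == v) ∧ not (p == v)
  harary-antipodal-adj {g} {p} 1≤g 1≤p ap v rewrite ==-toℕ g v | ==-toℕ p v =
    cong (not (toℕ g =ℕ toℕ v) ∧_) (antipodal-clause 1≤g 1≤p (toℕ<n p) (toℕ<n v) ap)

balance : ∀ k D s r {T} → k + k ≡ 2 * D + s → D + s + r ≡ T → k + k + (s + 2 * r) ≡ T + T
balance k D s r {T} k+k≡ D+s+r≡T = begin
  k + k + (s + 2 * r)            ≡⟨ cong (_+ (s + 2 * r)) k+k≡ ⟩
  2 * D + s + (s + 2 * r)        ≡⟨ regroup D s r ⟩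
  (D + s + r) + (D + s + r)      ≡⟨ cong₂ _+_ D+s+r≡T D+s+r≡T ⟩
  T + T                          ∎
  where
  open ≡-Reasoning
  regroup : ∀ D s r → 2 * D + s + (s + 2 * r) ≡ (D + s + r) + (D + s + r)
  regroup = solve-∀

+-2*-cancel : ∀ a b → a + 2 * b ≡ b + 2 * a → a ≡ b
+-2*-cancel a b eq = sym (+-cancelˡ-≡ (a + b) b a (trans (regroupˡ a b) (trans eq (regroupʳ a b))))
  where
  regroupˡ : ∀ a b → (a + b) + b ≡ a + 2 * b
  regroupˡ = solve-∀
  regroupʳ : ∀ a b → b + 2 * a ≡ (a + b) + a
  regroupʳ = solve-∀

module _ {m : ℕ} (k : ℕ) (S : Fin (2 * m + 3) → ℕ)
         (balanced : ∀ g → k + k ≡ 2 * nbrSum (harary m) S g + S g) where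

  apex-balance : ∀ {o} → toℕ o ≡ 0 → k + k + S o ≡ sum S + sum S
  apex-balance {o} o≡0 = trans (cong (k + k +_) (sym (+-identityʳ (S o))))
    (balance k _ (S o) 0 (balanced o)
      (trans (+-identityʳ _) (nbrSum-dominating (harary m) S o (harary-apex-adj o≡0))))

  antipodal-balance : ∀ {g p} → 1 ≤ toℕ g → 1 ≤ toℕ p → Antipodal m (toℕ g) (toℕ p) →
    k + k + (S g + 2 * S p) ≡ sum S + sum S
  antipodal-balance {g} {p} 1≤g 1≤p ap = balance k _ (S g) (S p) (balanced g)
    (nbrSum-all-but (harary m) S g (λ { refl → antipodal-irrefl ap }) (harary-antipodal-adj 1≤g 1≤p ap))

  harary-copy-sum : ∀ {o g} → toℕ o ≡ 0 → 1 ≤ toℕ g → 3 * S g ≡ S o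
  harary-copy-sum {o} {g} o≡0 1≤g with antipode {m} g 1≤g
  ... | p , 1≤p , ap = trans (cong (_+ 2 * S g) Sg≡Sp) (sym viaP)
    where
    viaG : S o ≡ S g + 2 * S p
    viaG = +-cancelˡ-≡ (k + k) _ _
      (trans (apex-balance o≡0) (sym (antipodal-balance 1≤g 1≤p ap)))
    viaP : S o ≡ S p + 2 * S g
    viaP = +-cancelˡ-≡ (k + k) _ _
      (trans (apex-balance o≡0) (sym (antipodal-balance 1≤p 1≤g (antipodal-sym ap))))
    Sg≡Sp : S g ≡ S p
    Sg≡Sp = +-2*-cancel (S g) (S p) (trans (sym viaG) viaP)

sum-from-thirds : ∀ {K} (S : Fin (suc K) → ℕ) → (∀ g → 3 * S (suc g) ≡ S zero) →
  3 * sum S ≡ (suc K + 2) * S zero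
sum-from-thirds {K} S thirds = begin
  3 * (S zero + sum (S ∘ suc))     ≡⟨ *-distribˡ-+ 3 (S zero) _ ⟩
  3 * S zero + 3 * sum (S ∘ suc)   ≡⟨ cong (3 * S zero +_) (*-sum-const 3 (S ∘ suc) thirds) ⟩
  3 * S zero + K * S zero          ≡⟨ *-distribʳ-+ (S zero) 3 K ⟨
  (3 + K) * S zero                 ≡⟨ cong (_* S zero) (+-comm (suc K) 2) ⟨
  (suc K + 2) * S zero             ∎
  where open ≡-Reasoning

apex-copy-sum-exceeds : ∀ M {S₀ T} → 4 ≤ M →
  2 * T ≡ (M * 4) * suc (M * 4) → 3 * T ≡ (M + 2) * S₀ → 4 * (M * 4) < S₀
apex-copy-sum-exceeds M {S₀} {T} 4≤M total thirds =
  ≰⇒> λ S₀≤4N → <⇒≱ lower (*-cancelˡ-≤ N {{N>0}} (upper S₀≤4N))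
  where
  N : ℕ
  N = M * 4
  N>0 : NonZero N
  N>0 = >-nonZero (≤-trans (≤-trans (s≤s z≤n) 4≤M) (m≤m*n M 4))
  upper : S₀ ≤ 4 * N → N * (3 * suc N) ≤ N * (8 * (M + 2))
  upper S₀≤4N = begin
    N * (3 * suc N)            ≡⟨ regroup₁ N (suc N) ⟩
    3 * (N * suc N)            ≡⟨ cong (3 *_) total ⟨
    3 * (2 * T)                ≡⟨ regroup₁ 2 T ⟨
    2 * (3 * T)                ≡⟨ cong (2 *_) thirds ⟩
    2 * ((M + 2) * S₀)         ≤⟨ *-monoʳ-≤ 2 (*-monoʳ-≤ (M + 2) S₀≤4N) ⟩
    2 * ((M + 2) * (4 * N))    ≡⟨ regroup₂ M N ⟩
    N * (8 * (M + 2))          ∎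
    where
    open ≤-Reasoning
    regroup₁ : ∀ a b → a * (3 * b) ≡ 3 * (a * b)
    regroup₁ = solve-∀
    regroup₂ : ∀ M N → 2 * ((M + 2) * (4 * N)) ≡ N * (8 * (M + 2))
    regroup₂ = solve-∀
  lower : 8 * (M + 2) < 3 * suc N
  lower = begin-strict
    8 * (M + 2)          ≡⟨ regroup₁ M ⟩
    8 * M + 4 * 4        ≤⟨ +-monoʳ-≤ (8 * M) (*-monoʳ-≤ 4 4≤M) ⟩
    8 * M + 4 * M        <⟨ m<m+n (8 * M + 4 * M) {3} (s≤s z≤n) ⟩
    8 * M + 4 * M + 3    ≡⟨ regroup₂ M ⟩
    3 * suc N            ∎
    where
    open ≤-Reasoning
    regroup₁ : ∀ M → 8 * (M + 2) ≡ 8 * M + 4 * 4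
    regroup₁ = solve-∀
    regroup₂ : ∀ M → 8 * M + 4 * M + 3 ≡ 3 * suc (M * 4)
    regroup₂ = solve-∀

mainTheorem6 : (n : ℕ) → ¬ DistanceMagic (harary (suc n) ∘ᴳ c4)
mainTheorem6 n (f , inj , surj , magic) =
  <⇒≱ (apex-copy-sum-exceeds M {S zero} {sum S} 4≤M total thirds) apexBound
  where
  M : ℕ
  M = 2 * suc n + 3
  S : Fin M → ℕ
  S = blockSum {M} {4} (label f)

  total : 2 * sum S ≡ (M * 4) * suc (M * 4)
  total = trans (cong (2 *_) (sym (sum-combine M 4 (label f)))) (sum-label f inj surj)

  thirds : 3 * sum S ≡ (M + 2) * S zero
  thirds = sum-from-thirds S λ g →
    harary-copy-sum {suc n} (weight (harary (suc n) ∘ᴳ c4) f zero) S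
      (balanced-copies (harary (suc n)) f magic zero) {zero} {suc g} refl (s≤s z≤n)

  apexBound : S zero ≤ 4 * (M * 4)
  apexBound = sum-≤ (label f ∘ combine {M} zero) (λ h → toℕ<n (f (combine {M} zero h)))

  4≤M : 4 ≤ M
  4≤M = ≤-trans (n≤1+n 4) (+-monoˡ-≤ 3 (*-monoʳ-≤ 2 (s≤s z≤n)))
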